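{- Let $B,C$ be nonzero integers with $\gcd(B,C)=1$, let $D$ be an integer, and let $X,Y,Z$ be positive integers. Let \[ \Sigma=\{(x,y,z)\in\mathbb{Z}^3: 0\le x\le X,\ 0\le y\le Y,\ 0\le z\le Z\},\qquad M=\#\{(x,y,z)\in\Sigma: By+Cz=D\}. \] Then \[ M\le(X+1)\Bigl(1+\Bigl\lfloor\frac{Y}{|C|}\Bigr\rfloor\Bigr)\quad\text{and}\quad M\le(X+1)\Bigl(1+\Bigl\lfloor\frac{Z}{|B|}\Bigr\rfloor\Bigr). \] If moreover $M\ge\max\{X+Y+1,\,X+Z+1\}$, then \[ |B|\le\frac{(X+1)(Z+1)}{M-X},\qquad |C|\le\frac{(X+1)(Y+1)}{M-X}. \] -}

module Defs where

open import Data.Nat as ℕ using (ℕ; zero; suc)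
open import Data.Nat.DivMod using (_/_)
open import Data.Integer as ℤ using (ℤ; +_)
open import Data.List using (List; length; filter; upTo; concatMap; map)
open import Data.Product using (_×_; _,_)
open import Relation.Binary.PropositionalEquality using (_≡_)

box : ℕ → ℕ → ℕ → List (ℕ × ℕ × ℕ)
box X Y Z =
  concatMap (λ x → concatMap (λ y → map (λ z → (x , y , z)) (upTo (suc Z)))
                              (upTo (suc Y)))
            (upTo (suc X))

countM : ℤ → ℤ → ℤ → ℕ → ℕ → ℕ → ℕ
countM B C D X Y Z =
  length (filter (λ { (x , y , z) → ℤ._≟_ (B ℤ.* + y ℤ.+ C ℤ.* + z) D })
                 (box X Y Z))

-- floor division of naturals; the divisor-zero case is never used
-- (the theorem assumes the divisor is |B| or |C| with B, C ≠ 0).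
floorDiv : ℕ → ℕ → ℕ
floorDiv m zero = zero
floorDiv m (suc k) = m / suc k

-- Points of Σ on the plane By + Cz = D are the triples (x, y, z) with x ∈ [0, X] free and
-- (y, z) a solution in [0, Y] × [0, Z], so M = (X + 1) N with N the number of such solutions.
-- As C ≠ 0 a solution is determined by y, and gcd(B, C) = 1 forces |C| ∣ y − y′ for any two
-- solutions, so N is at most the number of points of one residue class mod |C| in [0, Y],
-- i.e. 1 + ⌊Y/|C|⌋; symmetrically N ≤ 1 + ⌊Z/|B|⌋. For the second part write N = n + 1:
-- M ≥ X + Z + 1 gives Z ≤ (X + 1) n while |B| n ≤ Z, hence |B| ≤ X + 1 and
-- |B| (M − X) = |B| + (X + 1) |B| n ≤ (X + 1)(Z + 1).
module Submission where

open import Defs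
open import Algebra.Bundles using (AbelianGroup)
open import Data.Integer as ℤ using (ℤ; ∣_∣)
import Data.Integer.Properties as ℤ
open import Data.Integer.Coprimality as ℤCoprime using (Coprime; coprime-divisor)
open import Data.Integer.GCD using (gcd)
open import Data.Integer.Tactic.RingSolver using (solve-∀)
open import Data.List using (List; _++_; length; filter; map; concat; concatMap; applyUpTo; upTo)
open import Data.List.Properties using (length-++; filter-++; map-applyUpTo)
open import Data.Nat as ℕ
  using (ℕ; zero; suc; _+_; _*_; _∸_; _⊔_; _≤_; _<_; _/_; _%_; ∣_-_∣; NonZero; z≤n; s≤s)
import Data.Nat.Properties as ℕ
open import Data.Nat.Coprimality using (gcd≡1⇒coprime)
open import Data.Nat.DivMod using (m≡m%n+[m/n]*n; m%n<n; m<n⇒m%n≡m; m/n*n≤m)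
open import Data.Nat.Divisibility as ℕ∣ using (_∣_; n∣m⇒m%n≡0)
open import Data.Product using (_×_; _,_; ∃-syntax)
open import Data.Sum using (inj₁; inj₂)
open import Function using (_∘_; const)
open import Relation.Binary.PropositionalEquality
open import Relation.Nullary using (Dec; yes; no)
open import Relation.Unary using (Pred; Decidable)
open import Algebra.Properties.CommutativeSemigroup ℕ.+-commutativeSemigroup using (interchange)
open import Algebra.Properties.CommutativeSemigroup ℕ.*-commutativeSemigroup using (x∙yz≈y∙xz)
open import Algebra.Properties.Group (AbelianGroup.group ℤ.+-0-abelianGroup) using (∙-cancelˡ)

∑ : ℕ → (ℕ → ℕ) → ℕ
∑ zero    f = 0
∑ (suc n) f = f 0 + ∑ n (f ∘ suc)

∑-cong : ∀ n {f g} → (∀ i → f i ≡ g i) → ∑ n f ≡ ∑ n g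
∑-cong zero    f≗g = refl
∑-cong (suc n) f≗g = cong₂ _+_ (f≗g 0) (∑-cong n (f≗g ∘ suc))

∑-const : ∀ n c → ∑ n (const c) ≡ n * c
∑-const zero    c = refl
∑-const (suc n) c = cong (c +_) (∑-const n c)

∑-+ : ∀ n f g → ∑ n (λ i → f i + g i) ≡ ∑ n f + ∑ n g
∑-+ zero    f g = refl
∑-+ (suc n) f g =
  trans (cong (f 0 + g 0 +_) (∑-+ n (f ∘ suc) (g ∘ suc))) (interchange (f 0) (g 0) _ _)

∑-comm : ∀ m n (h : ℕ → ℕ → ℕ) →
         ∑ m (λ i → ∑ n (h i)) ≡ ∑ n (λ j → ∑ m (λ i → h i j))
∑-comm zero    n h = sym (trans (∑-const n 0) (ℕ.*-zeroʳ n))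
∑-comm (suc m) n h =
  trans (cong (∑ n (h 0) +_) (∑-comm m n (h ∘ suc))) (sym (∑-+ n (h 0) _))

∑-++ : ∀ m n f → ∑ (m + n) f ≡ ∑ m f + ∑ n (λ i → f (m + i))
∑-++ zero    n f = refl
∑-++ (suc m) n f =
  trans (cong (f 0 +_) (∑-++ m n (f ∘ suc))) (sym (ℕ.+-assoc (f 0) _ _))

∑>0⇒∃ : ∀ n f → 0 < ∑ n f → ∃[ i ] i < n × 0 < f i
∑>0⇒∃ (suc n) f 0<∑ with f 0 in f0
... | suc _ = 0 , s≤s z≤n , subst (0 <_) (sym f0) (s≤s z≤n)
... | zero with i , i<n , 0<fi ← ∑>0⇒∃ n (f ∘ suc) 0<∑ = suc i , s≤s i<n , 0<fi

∑-≤1 : ∀ n f → (∀ i → f i ≤ 1) →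
       (∀ {i j} → i < n → j < n → 0 < f i → 0 < f j → i ≡ j) → ∑ n f ≤ 1
∑-≤1 zero    f f≤1 unique = z≤n
∑-≤1 (suc n) f f≤1 unique with f 0 in f0
... | zero  = ∑-≤1 n (f ∘ suc) (f≤1 ∘ suc)
                λ i<n j<n fi fj → ℕ.suc-injective (unique (s≤s i<n) (s≤s j<n) fi fj)
... | suc k = begin
  suc k + ∑ n (f ∘ suc)  ≡⟨ cong (suc k +_) rest≡0 ⟩
  suc k + 0              ≡⟨ ℕ.+-identityʳ (suc k) ⟩
  suc k                  ≡⟨ f0 ⟨
  f 0                    ≤⟨ f≤1 0 ⟩
  1                      ∎
  where
  open ℕ.≤-Reasoning
  rest≡0 : ∑ n (f ∘ suc) ≡ 0
  rest≡0 = ℕ.n≤0⇒n≡0 (ℕ.≮⇒≥ λ 0<∑ →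
    let i , i<n , 0<fi = ∑>0⇒∃ n (f ∘ suc) 0<∑
    in ℕ.0≢1+n (unique (s≤s z≤n) (s≤s i<n) (subst (0 <_) (sym f0) (s≤s z≤n)) 0<fi))

CongruentSupport : ℕ → (ℕ → ℕ) → Set
CongruentSupport c f = ∀ i j → 0 < f i → 0 < f j → c ∣ ∣ i - j ∣

congruentSupport-shift : ∀ {c f} k → CongruentSupport c f → CongruentSupport c (λ i → f (k + i))
congruentSupport-shift k cs i j fi fj =
  subst (_ ∣_) (ℕ.∣m+n-m+o∣≡∣n-o∣ k i j) (cs (k + i) (k + j) fi fj)

∣∧<⇒≡0 : ∀ {c d} .{{_ : NonZero c}} → c ∣ d → d < c → d ≡ 0
∣∧<⇒≡0 {c} {d} c∣d d<c = trans (sym (m<n⇒m%n≡m d<c)) (n∣m⇒m%n≡0 d c c∣d)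

∑-window : ∀ {c r} .{{_ : NonZero c}} f → (∀ i → f i ≤ 1) → CongruentSupport c f →
           r ≤ c → ∑ r f ≤ 1
∑-window {r = r} f f≤1 cs r≤c = ∑-≤1 r f f≤1 λ {i} {j} i<r j<r fi fj →
  ℕ.∣m-n∣≡0⇒m≡n (∣∧<⇒≡0 (cs i j fi fj)
    (ℕ.≤-<-trans (ℕ.∣m-n∣≤m⊔n i j) (ℕ.<-≤-trans (ℕ.⊔-pres-<m i<r j<r) r≤c)))

∑-blocks : ∀ {c} .{{_ : NonZero c}} q {r} f → (∀ i → f i ≤ 1) → CongruentSupport c f →
           r ≤ c → ∑ (q * c + r) f ≤ suc q
∑-blocks zero    f f≤1 cs r≤c = ∑-window f f≤1 cs r≤c
∑-blocks {c} (suc q) {r} f f≤1 cs r≤c = begin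
  ∑ (c + q * c + r) f                      ≡⟨ cong (λ n → ∑ n f) (ℕ.+-assoc c (q * c) r) ⟩
  ∑ (c + (q * c + r)) f                    ≡⟨ ∑-++ c _ f ⟩
  ∑ c f + ∑ (q * c + r) (λ i → f (c + i))  ≤⟨ ℕ.+-mono-≤ first-window remaining-blocks ⟩
  suc (suc q)                              ∎
  where
  open ℕ.≤-Reasoning
  first-window : ∑ c f ≤ 1
  first-window = ∑-window f f≤1 cs ℕ.≤-refl
  remaining-blocks : ∑ (q * c + r) (λ i → f (c + i)) ≤ suc q
  remaining-blocks = ∑-blocks q _ (f≤1 ∘ (c +_)) (congruentSupport-shift c cs) r≤c

∑-congruentSupport : ∀ c .{{_ : NonZero c}} n f → (∀ i → f i ≤ 1) → CongruentSupport c f →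
                     ∑ (suc n) f ≤ suc (n / c)
∑-congruentSupport c n f f≤1 cs =
  subst (λ m → ∑ m f ≤ suc (n / c)) [n/c]*c+[1+n%c]≡1+n (∑-blocks (n / c) f f≤1 cs (m%n<n n c))
  where
  [n/c]*c+[1+n%c]≡1+n : n / c * c + suc (n % c) ≡ suc n
  [n/c]*c+[1+n%c]≡1+n = trans (ℕ.+-suc _ _)
    (cong suc (trans (ℕ.+-comm _ (n % c)) (sym (m≡m%n+[m/n]*n n c))))

∑∑-bound : ∀ c .{{_ : NonZero c}} m n (h : ℕ → ℕ → ℕ) →
           (∀ y z → h y z ≤ 1) →
           (∀ y z z′ → 0 < h y z → 0 < h y z′ → z ≡ z′) →
           (∀ y y′ z z′ → 0 < h y z → 0 < h y′ z′ → c ∣ ∣ y - y′ ∣) →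
           ∑ (suc m) (λ y → ∑ n (h y)) ≤ suc (m / c)
∑∑-bound c m n h h≤1 unique congruent =
  ∑-congruentSupport c m (λ y → ∑ n (h y)) row≤1 rowsCongruent
  where
  row≤1 : ∀ y → ∑ n (h y) ≤ 1
  row≤1 y = ∑-≤1 n (h y) (h≤1 y) λ _ _ → unique y _ _
  rowsCongruent : CongruentSupport c (λ y → ∑ n (h y))
  rowsCongruent y y′ 0<row 0<row′ =
    let z  , _ , 0<h  = ∑>0⇒∃ n (h y)  0<row
        z′ , _ , 0<h′ = ∑>0⇒∃ n (h y′) 0<row′
    in congruent y y′ z z′ 0<h 0<h′

indicator : ∀ {p} {P : Set p} → Dec P → ℕ
indicator (yes _) = 1
indicator (no _)  = 0

indicator≤1 : ∀ {p} {P : Set p} (P? : Dec P) → indicator P? ≤ 1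
indicator≤1 (yes _) = s≤s z≤n
indicator≤1 (no _)  = z≤n

indicator>0⇒ : ∀ {p} {P : Set p} (P? : Dec P) → 0 < indicator P? → P
indicator>0⇒ (yes p) _ = p

module _ {a p} {A : Set a} {P : Pred A p} (P? : Decidable P) where

  length-filter-applyUpTo : ∀ (F : ℕ → A) n →
                            length (filter P? (applyUpTo F n)) ≡ ∑ n (indicator ∘ P? ∘ F)
  length-filter-applyUpTo F zero = refl
  length-filter-applyUpTo F (suc n) with P? (F 0)
  ... | yes _ = cong suc (length-filter-applyUpTo (F ∘ suc) n)
  ... | no _  = length-filter-applyUpTo (F ∘ suc) n

  length-filter-concat-applyUpTo : ∀ (G : ℕ → List A) n →
    length (filter P? (concat (applyUpTo G n))) ≡ ∑ n (length ∘ filter P? ∘ G)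
  length-filter-concat-applyUpTo G zero = refl
  length-filter-concat-applyUpTo G (suc n) = begin
    length (filter P? (G 0 ++ concat (applyUpTo (G ∘ suc) n)))
      ≡⟨ cong length (filter-++ P? (G 0) _) ⟩
    length (filter P? (G 0) ++ filter P? (concat (applyUpTo (G ∘ suc) n)))
      ≡⟨ length-++ (filter P? (G 0)) ⟩
    length (filter P? (G 0)) + length (filter P? (concat (applyUpTo (G ∘ suc) n)))
      ≡⟨ cong (length (filter P? (G 0)) +_) (length-filter-concat-applyUpTo (G ∘ suc) n) ⟩
    length (filter P? (G 0)) + ∑ n (length ∘ filter P? ∘ G ∘ suc)
      ∎
    where open ≡-Reasoning

  length-filter-map-upTo : ∀ (F : ℕ → A) n →
                           length (filter P? (map F (upTo n))) ≡ ∑ n (indicator ∘ P? ∘ F)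
  length-filter-map-upTo F n =
    trans (cong (length ∘ filter P?) (map-applyUpTo _ F n)) (length-filter-applyUpTo F n)

  length-filter-concatMap-upTo : ∀ (G : ℕ → List A) n →
    length (filter P? (concatMap G (upTo n))) ≡ ∑ n (length ∘ filter P? ∘ G)
  length-filter-concatMap-upTo G n =
    trans (cong (length ∘ filter P? ∘ concat) (map-applyUpTo _ G n))
          (length-filter-concat-applyUpTo G n)

linear : ℤ → ℤ → ℕ → ℕ → ℤ
linear B C y z = B ℤ.* ℤ.+ y ℤ.+ C ℤ.* ℤ.+ z

solutionCount : ℤ → ℤ → ℤ → ℕ → ℕ → ℕ
solutionCount B C D Y Z = ∑ (suc Y) λ y → ∑ (suc Z) λ z → indicator (linear B C y z ℤ.≟ D)

length-filter-box : ∀ {p} {P : Pred (ℕ × ℕ × ℕ) p} (P? : Decidable P) X Y Z →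
  length (filter P? (box X Y Z))
    ≡ ∑ (suc X) λ x → ∑ (suc Y) λ y → ∑ (suc Z) λ z → indicator (P? (x , y , z))
length-filter-box P? X Y Z =
  trans (length-filter-concatMap-upTo P? plane (suc X)) (∑-cong (suc X) λ x →
    trans (length-filter-concatMap-upTo P? (line x) (suc Y)) (∑-cong (suc Y) λ y →
      length-filter-map-upTo P? (λ z → x , y , z) (suc Z)))
  where
  line : ℕ → ℕ → List (ℕ × ℕ × ℕ)
  line x y = map (λ z → x , y , z) (upTo (suc Z))
  plane : ℕ → List (ℕ × ℕ × ℕ)
  plane x = concatMap (line x) (upTo (suc Y))

countM≡ : ∀ B C D X Y Z → countM B C D X Y Z ≡ suc X * solutionCount B C D Y Z
countM≡ B C D X Y Z =
  -- the filter predicate of countM cannot be inferred by unification, so it is restated here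
  trans (length-filter-box (λ (_ , y , z) → linear B C y z ℤ.≟ D) X Y Z)
        (∑-const (suc X) (solutionCount B C D Y Z))

solutionCount-comm : ∀ B C D Y Z → solutionCount B C D Y Z ≡ solutionCount C B D Z Y
solutionCount-comm B C D Y Z =
  trans (∑-comm (suc Y) (suc Z) (λ y z → indicator (linear B C y z ℤ.≟ D)))
        (∑-cong (suc Z) λ z → ∑-cong (suc Y) λ y →
           cong (λ t → indicator (t ℤ.≟ D)) (ℤ.+-comm (B ℤ.* ℤ.+ y) (C ℤ.* ℤ.+ z)))

m≤n⇒∣[+m]-[+n]∣≡∣m-n∣ : ∀ {m n} → m ≤ n → ℤ.∣ ℤ.+ m ℤ.- ℤ.+ n ∣ ≡ ∣ m - n ∣
m≤n⇒∣[+m]-[+n]∣≡∣m-n∣ {m} {n} m≤n = begin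
  ℤ.∣ ℤ.+ m ℤ.- ℤ.+ n ∣  ≡⟨ cong ℤ.∣_∣ (ℤ.[+m]-[+n]≡m⊖n m n) ⟩
  ℤ.∣ m ℤ.⊖ n ∣          ≡⟨ ℤ.∣⊖∣-≤ m≤n ⟩
  n ∸ m                  ≡⟨ ℕ.m≤n⇒∣m-n∣≡n∸m m≤n ⟨
  ∣ m - n ∣              ∎
  where open ≡-Reasoning

∣[+m]-[+n]∣≡∣m-n∣ : ∀ m n → ℤ.∣ ℤ.+ m ℤ.- ℤ.+ n ∣ ≡ ∣ m - n ∣
∣[+m]-[+n]∣≡∣m-n∣ m n with ℕ.≤-total m n
... | inj₁ m≤n = m≤n⇒∣[+m]-[+n]∣≡∣m-n∣ m≤n
... | inj₂ n≤m = begin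
  ℤ.∣ ℤ.+ m ℤ.- ℤ.+ n ∣  ≡⟨ ℤ.∣i-j∣≡∣j-i∣ (ℤ.+ m) (ℤ.+ n) ⟩
  ℤ.∣ ℤ.+ n ℤ.- ℤ.+ m ∣  ≡⟨ m≤n⇒∣[+m]-[+n]∣≡∣m-n∣ n≤m ⟩
  ∣ n - m ∣              ≡⟨ ℕ.∣-∣-comm n m ⟩
  ∣ m - n ∣              ∎
  where open ≡-Reasoning

linear-injectiveʳ : ∀ B C {y z z′} .{{_ : ℤ.NonZero C}} →
                    linear B C y z ≡ linear B C y z′ → z ≡ z′
linear-injectiveʳ B C {y} {z} {z′} eq =
  ℤ.+-injective (ℤ.*-cancelˡ-≡ C (ℤ.+ z) (ℤ.+ z′) (∙-cancelˡ (B ℤ.* ℤ.+ y) _ _ eq))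

linear-difference : ∀ B C y y′ z z′ →
  B ℤ.* (y ℤ.- y′) ℤ.- C ℤ.* (z′ ℤ.- z) ≡ (B ℤ.* y ℤ.+ C ℤ.* z) ℤ.- (B ℤ.* y′ ℤ.+ C ℤ.* z′)
linear-difference = solve-∀

linear-∣ : ∀ B C {y y′ z z′} → Coprime C B →
           linear B C y z ≡ linear B C y′ z′ → ∣ C ∣ ∣ ∣ y - y′ ∣
linear-∣ B C {y} {y′} {z} {z′} coprime eq =
  subst (∣ C ∣ ∣_) (∣[+m]-[+n]∣≡∣m-n∣ y y′) (coprime-divisor C B Δy coprime C∣BΔy)
  where
  Δy Δz : ℤ
  Δy = ℤ.+ y ℤ.- ℤ.+ y′
  Δz = ℤ.+ z′ ℤ.- ℤ.+ z
  BΔy≡CΔz : B ℤ.* Δy ≡ C ℤ.* Δz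
  BΔy≡CΔz = ℤ.i-j≡0⇒i≡j _ _ (begin
    B ℤ.* Δy ℤ.- C ℤ.* Δz                          ≡⟨ linear-difference B C _ _ _ _ ⟩
    linear B C y z ℤ.- linear B C y′ z′            ≡⟨ cong (ℤ._- linear B C y′ z′) eq ⟩
    linear B C y′ z′ ℤ.- linear B C y′ z′          ≡⟨ ℤ.+-inverseʳ (linear B C y′ z′) ⟩
    ℤ.0ℤ                                          ∎)
    where open ≡-Reasoning
  C∣BΔy : ∣ C ∣ ∣ ℤ.∣ B ℤ.* Δy ∣
  C∣BΔy = subst (∣ C ∣ ∣_) (trans (sym (ℤ.abs-* C Δz)) (cong ℤ.∣_∣ (sym BΔy≡CΔz)))
                (ℕ∣.m∣m*n ℤ.∣ Δz ∣)

solutionCount≤ : ∀ B C D Y Z .{{_ : ℤ.NonZero C}} → Coprime C B →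
                 solutionCount B C D Y Z ≤ suc (Y / ∣ C ∣)
solutionCount≤ B C D Y Z coprime =
  ∑∑-bound ∣ C ∣ Y (suc Z) solves (λ y z → indicator≤1 _) unique congruent
  where
  solves : ℕ → ℕ → ℕ
  solves y z = indicator (linear B C y z ℤ.≟ D)
  solution : ∀ {y z} → 0 < solves y z → linear B C y z ≡ D
  solution {y} {z} = indicator>0⇒ (linear B C y z ℤ.≟ D)
  unique : ∀ y z z′ → 0 < solves y z → 0 < solves y z′ → z ≡ z′
  unique y z z′ p q = linear-injectiveʳ B C (trans (solution p) (sym (solution q)))
  congruent : ∀ y y′ z z′ → 0 < solves y z → 0 < solves y′ z′ → ∣ C ∣ ∣ ∣ y - y′ ∣
  congruent y y′ z z′ p q = linear-∣ B C coprime (trans (solution p) (sym (solution q)))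

≤1+/⇒*pred≤ : ∀ {n m} b .{{_ : NonZero b}} → n ≤ suc (m / b) → b * ℕ.pred n ≤ m
≤1+/⇒*pred≤ {n} {m} b n≤1+m/b = begin
  b * ℕ.pred n  ≤⟨ ℕ.*-monoʳ-≤ b (ℕ.pred-mono-≤ n≤1+m/b) ⟩
  b * (m / b)   ≡⟨ ℕ.*-comm b (m / b) ⟩
  m / b * b     ≤⟨ m/n*n≤m m b ⟩
  m             ∎
  where open ℕ.≤-Reasoning

b*[1+a*n]≤a*[1+m] : ∀ a b n m → b * n ≤ m → m ≤ a * n → 0 < m → b * suc (a * n) ≤ a * suc m
b*[1+a*n]≤a*[1+m] a b zero m _ m≤a*0 0<m
  with () ← ℕ.<-≤-trans 0<m (ℕ.≤-trans m≤a*0 (ℕ.≤-reflexive (ℕ.*-zeroʳ a)))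
b*[1+a*n]≤a*[1+m] a b n@(suc _) m bn≤m m≤an 0<m = begin
  b * suc (a * n)  ≡⟨ ℕ.*-suc b (a * n) ⟩
  b + b * (a * n)  ≡⟨ cong (b +_) (x∙yz≈y∙xz b a n) ⟩
  b + a * (b * n)  ≤⟨ ℕ.+-mono-≤ b≤a (ℕ.*-monoʳ-≤ a bn≤m) ⟩
  a + a * m        ≡⟨ ℕ.*-suc a m ⟨
  a * suc m        ∎
  where
  open ℕ.≤-Reasoning
  b≤a : b ≤ a
  b≤a = ℕ.*-cancelʳ-≤ b a n (ℕ.≤-trans bn≤m m≤an)

excess-bound : ∀ X m N b .{{_ : NonZero b}} → N ≤ suc (m / b) → 0 < m →
               suc (X + m) ≤ suc X * N → b * (suc X * N ∸ X) ≤ suc X * suc m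
excess-bound X m zero b _ _ M≥ with () ← ℕ.≤-trans M≥ (ℕ.≤-reflexive (ℕ.*-zeroʳ (suc X)))
excess-bound X m (suc n) b N≤1+m/b 0<m M≥ = begin
  b * (suc X * suc n ∸ X)  ≡⟨ cong (b *_) M∸X≡1+Xn ⟩
  b * suc (suc X * n)      ≤⟨ b*[1+a*n]≤a*[1+m] (suc X) b n m (≤1+/⇒*pred≤ b N≤1+m/b) m≤Xn 0<m ⟩
  suc X * suc m            ∎
  where
  open ℕ.≤-Reasoning
  M∸X≡1+Xn : suc X * suc n ∸ X ≡ suc (suc X * n)
  M∸X≡1+Xn = trans (cong (_∸ X) (trans (ℕ.*-suc (suc X) n) (sym (ℕ.+-suc X _))))
                   (ℕ.m+n∸m≡n X _)
  m≤Xn : m ≤ suc X * n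
  m≤Xn = ℕ.+-cancelˡ-≤ (suc X) m (suc X * n) (ℕ.≤-trans M≥ (ℕ.≤-reflexive (ℕ.*-suc (suc X) n)))

floorDiv≡/ : ∀ m n .{{_ : NonZero n}} → floorDiv m n ≡ m / n
floorDiv≡/ m (suc n) = refl

corollary14p6 : (B C D : ℤ) (X Y Z : ℕ) →
    B ≢ ℤ.0ℤ → C ≢ ℤ.0ℤ → gcd B C ≡ ℤ.1ℤ →
    1 ≤ X → 1 ≤ Y → 1 ≤ Z →
    let M = countM B C D X Y Z in
    (M ≤ suc X ℕ.* suc (floorDiv Y ∣ C ∣)
      × M ≤ suc X ℕ.* suc (floorDiv Z ∣ B ∣))
    × ((suc (X ℕ.+ Y) ⊔ suc (X ℕ.+ Z)) ≤ M →
        (∣ B ∣ ℕ.* (M ∸ X) ≤ suc X ℕ.* suc Z)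
        × (∣ C ∣ ℕ.* (M ∸ X) ≤ suc X ℕ.* suc Y))
corollary14p6 B C D X Y Z B≢0 C≢0 gcd≡1 _ 0<Y 0<Z rewrite countM≡ B C D X Y Z =
  ( ℕ.*-monoʳ-≤ (suc X) (≤1+floorDiv Y (∣ C ∣) N≤1+Y/C)
  , ℕ.*-monoʳ-≤ (suc X) (≤1+floorDiv Z (∣ B ∣) N≤1+Z/B)) ,
  λ M≥ → excess-bound X Z N (∣ B ∣) N≤1+Z/B 0<Z (ℕ.m⊔n≤o⇒n≤o (suc (X + Y)) _ M≥)
       , excess-bound X Y N (∣ C ∣) N≤1+Y/C 0<Y (ℕ.m⊔n≤o⇒m≤o _ (suc (X + Z)) M≥)
  where
  instance
    B-nonZero : ℤ.NonZero B
    B-nonZero = ℤ.≢-nonZero B≢0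
    C-nonZero : ℤ.NonZero C
    C-nonZero = ℤ.≢-nonZero C≢0
  N : ℕ
  N = solutionCount B C D Y Z
  coprime : Coprime B C
  coprime = gcd≡1⇒coprime (ℤ.+-injective gcd≡1)
  N≤1+Y/C : N ≤ suc (Y / ∣ C ∣)
  N≤1+Y/C = solutionCount≤ B C D Y Z (ℤCoprime.sym {B} {C} coprime)
  N≤1+Z/B : N ≤ suc (Z / ∣ B ∣)
  N≤1+Z/B = subst (_≤ suc (Z / ∣ B ∣)) (sym (solutionCount-comm B C D Y Z))
                  (solutionCount≤ C B D Z Y coprime)
  ≤1+floorDiv : ∀ m n .{{_ : NonZero n}} → N ≤ suc (m / n) → N ≤ suc (floorDiv m n)
  ≤1+floorDiv m n = subst (λ q → N ≤ suc q) (sym (floorDiv≡/ m n))
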